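{- Let $G_1$ be a reduced graph (as defined in the context) and let $H$ be any maximum path-cycle cover of $G_1$. If $p$ is a path component of $H$ with exactly three edges, then the two endpoints of $p$ are not both leaves of $G_1$.
   Context: Throughout, $G_1$ is a connected undirected simple graph which is not a tree and which is reduced, meaning: (R1) every edge of $G_1$ whose two ends are each adjacent to a leaf (degree-$1$ vertex) of $G_1$ is a cut edge of $G_1$; (R2) no cut vertex of $G_1$ adjacent to a leaf of $G_1$ is super (a cut vertex is super if deleting it increases the number of connected components by at least $2$). Moreover it is assumed that no maximum path-cycle cover of $G_1$ consists of a single connected component. A path-cycle cover of $G_1$ is a spanning subgraph in which every vertex has degree at most $2$; it is maximum if it has the maximum number of edges among all path-cycle covers. Its connected components are path components and cycle components; the length of a path is its number of edges. A vertex of a path component is inner if its degree in the path is $2$ and an endpoint otherwise. -}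

module Defs where

open import Data.Nat using (ℕ; zero; suc; _+_; _≤_; _<_)
open import Data.Fin using (Fin; toℕ; inject₁; fromℕ) renaming (zero to fzero; suc to fsuc)
open import Data.Bool using (Bool; true; false; if_then_else_)
open import Data.List using (List; map; allFin; concatMap)
open import Data.Nat.ListAction using (sum)
open import Data.Product using (Σ; _×_; ∃; _,_)
open import Relation.Nullary using (¬_)
open import Relation.Binary.PropositionalEquality using (_≡_; _≢_)
open import Relation.Binary.Construct.Closure.ReflexiveTransitive using (Star)
open import Function.Definitions using (Injective)

record Graph (n : ℕ) : Set where
  field
    adj    : Fin n → Fin n → Bool
    sym    : ∀ u v → adj u v ≡ adj v u
    irrefl : ∀ u → adj u u ≡ false
open Graph public

Adj : ∀ {n} → Graph n → Fin n → Fin n → Set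
Adj G u v = adj G u v ≡ true

deg : ∀ {n} → (Fin n → Fin n → Bool) → Fin n → ℕ
deg {n} A u = sum (map (λ v → if A u v then 1 else 0) (allFin n))

-- number of edges (unordered pairs {u,v}, counted once via toℕ u < toℕ v)
edgeCount : ∀ {n} → (Fin n → Fin n → Bool) → ℕ
edgeCount {n} A =
  sum (concatMap (λ u → map (λ v → if A u v then (lt (toℕ u) (toℕ v)) else 0) (allFin n)) (allFin n))
  where
  lt : ℕ → ℕ → ℕ
  lt zero    zero    = 0
  lt zero    (suc _) = 1
  lt (suc _) zero    = 0
  lt (suc a) (suc b) = lt a b

Leaf : ∀ {n} → Graph n → Fin n → Set
Leaf G u = deg (adj G) u ≡ 1

Connected : ∀ {n} → Graph n → Set
Connected {n} G = ∀ (u v : Fin n) → Star (Adj G) u v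

HasCycle : ∀ {n} → Graph n → Set
HasCycle {n} G =
  Σ ℕ λ k → Σ (Fin (suc (suc (suc k))) → Fin n) λ f →
    Injective _≡_ _≡_ f ×
    (∀ (i : Fin (suc (suc k))) → Adj G (f (inject₁ i)) (f (fsuc i))) ×
    Adj G (f (fromℕ (suc (suc k)))) (f fzero)

IsTree : ∀ {n} → Graph n → Set
IsTree G = Connected G × ¬ HasCycle G

-- Components of the graph with vertex set {w | P w} and edge relation A
-- (A is assumed to only relate vertices satisfying P).
-- "at least k components": k vertices of the graph, pairwise not joined by a walk.
AtLeastComps : ∀ {n} → (Fin n → Set) → (Fin n → Fin n → Set) → ℕ → Set
AtLeastComps {n} P A k =
  Σ (Fin k → Fin n) λ f → (∀ i → P (f i)) × (∀ i j → i ≢ j → ¬ Star A (f i) (f j))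

NumComps : ∀ {n} → (Fin n → Set) → (Fin n → Fin n → Set) → ℕ → Set
NumComps P A c = AtLeastComps P A c × ¬ AtLeastComps P A (suc c)

AllV : ∀ {n} → Fin n → Set
AllV _ = Data.Unit.⊤ where import Data.Unit

DelVAdj : ∀ {n} → Graph n → Fin n → Fin n → Fin n → Set
DelVAdj G x u v = Adj G u v × u ≢ x × v ≢ x

DelEAdj : ∀ {n} → Graph n → Fin n → Fin n → Fin n → Fin n → Set
DelEAdj G a b u v = Adj G u v × ¬ ((u ≡ a × v ≡ b) Data.Sum.⊎ (u ≡ b × v ≡ a))
  where import Data.Sum

CutEdge : ∀ {n} → Graph n → Fin n → Fin n → Set
CutEdge G a b = Adj G a b × Σ ℕ λ c → Σ ℕ λ c' →
  NumComps AllV (Adj G) c × NumComps AllV (DelEAdj G a b) c' × c < c'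

IncreasesBy : ∀ {n} → Graph n → Fin n → ℕ → Set
IncreasesBy G x d = Σ ℕ λ c → Σ ℕ λ c' →
  NumComps AllV (Adj G) c × NumComps (λ w → w ≢ x) (DelVAdj G x) c' × c + d ≤ c'

CutVertex : ∀ {n} → Graph n → Fin n → Set
CutVertex G x = IncreasesBy G x 1

SuperCutVertex : ∀ {n} → Graph n → Fin n → Set
SuperCutVertex G x = CutVertex G x × IncreasesBy G x 2

AdjToLeaf : ∀ {n} → Graph n → Fin n → Set
AdjToLeaf G u = ∃ λ x → Adj G u x × Leaf G x

R1 : ∀ {n} → Graph n → Set
R1 G = ∀ u v → Adj G u v → AdjToLeaf G u → AdjToLeaf G v → CutEdge G u v

R2 : ∀ {n} → Graph n → Set
R2 G = ∀ x → AdjToLeaf G x → ¬ SuperCutVertex G x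

Reduced : ∀ {n} → Graph n → Set
Reduced G = R1 G × R2 G

record IsPCC {n} (G : Graph n) (H : Fin n → Fin n → Bool) : Set where
  field
    symH : ∀ u v → H u v ≡ H v u
    sub  : ∀ u v → H u v ≡ true → Adj G u v
    deg≤2 : ∀ u → deg H u ≤ 2

IsMaxPCC : ∀ {n} → Graph n → (Fin n → Fin n → Bool) → Set
IsMaxPCC G H = IsPCC G H × (∀ H' → IsPCC G H' → edgeCount H' ≤ edgeCount H)

HAdj : ∀ {n} → (Fin n → Fin n → Bool) → Fin n → Fin n → Set
HAdj H u v = H u v ≡ true

SingleComponent : ∀ {n} → (Fin n → Fin n → Bool) → Set
SingleComponent H = NumComps AllV (HAdj H) 1

-- a , b , c , d is a path component of H with exactly three edges
-- (endpoints a, d; inner vertices b, c): four distinct vertices, edges ab, bc, cd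
-- in H, endpoints of H-degree 1 and inner vertices of H-degree 2, so no other
-- H-edge touches them and the component of H is exactly this path.
PathComp3 : ∀ {n} → (Fin n → Fin n → Bool) → Fin n → Fin n → Fin n → Fin n → Set
PathComp3 H a b c d =
  (a ≢ b × a ≢ c × a ≢ d × b ≢ c × b ≢ d × c ≢ d) ×
  (HAdj H a b × HAdj H b c × HAdj H c d) ×
  (deg H a ≡ 1 × deg H b ≡ 2 × deg H c ≡ 2 × deg H d ≡ 1)

-- Let a–b–c–d be the path and suppose a and d are leaves of G. By (R1) the
-- edge bc is a cut edge. If c had a neighbour y other than b and d, then
-- G − c would separate d (a leaf hanging off c), b and y (a walk from b to y
-- avoiding c, followed by yc, would reconnect b and c in G − bc), so c would
-- be a super cut vertex adjacent to a leaf, contradicting (R2). Hence c, and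
-- symmetrically b, has no neighbours outside the path, G is the path a–b–c–d
-- itself, and only b and c have two distinct neighbours; a cycle needs three
-- such vertices, so G would be a tree.
module Submission where

open import Defs
open import Data.Nat using (ℕ; zero; suc; _+_; _≤_; z≤n; s≤s; _≤?_)
open import Data.Nat.Properties
  using (≤-trans; ≤-reflexive; +-comm; +-suc; +-identityʳ; <-irrefl; m≤m+n; m≤n+m; +-monoʳ-≤; ≰⇒>)
open import Data.Fin using (Fin; inject≤; _≟_; inject₁; fromℕ) renaming (zero to fzero; suc to fsuc)
open import Data.Fin.Properties using (inject≤-injective; injective⇒≤)
open import Data.Bool using (Bool; if_then_else_)
open import Data.List using (List; _∷_; map; allFin)
open import Data.List.Relation.Unary.Any using (here; there)
open import Data.List.Membership.Propositional using (_∈_)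
open import Data.List.Membership.Propositional.Properties using (∈-allFin)
open import Data.Nat.ListAction using (sum)
open import Data.Product using (_×_; ∃; ∃₂; _,_; proj₁)
open import Data.Sum using (_⊎_; inj₁; inj₂)
open import Data.Unit using (tt)
open import Data.Empty using (⊥; ⊥-elim)
open import Function using (_∘_)
open import Function.Definitions using (Injective)
open import Relation.Nullary using (¬_; yes; no)
open import Relation.Binary.PropositionalEquality
  using (_≡_; _≢_; refl; trans; subst; ≢-sym) renaming (sym to ≡-sym)
open import Relation.Binary.Construct.Closure.ReflexiveTransitive
  using (Star; ε; _◅_; _◅◅_; reverse) renaming (map to Star-map)

module _ {n : ℕ} (P : Fin n → Set) (A : Fin n → Fin n → Set) where

  atLeastComps-mono : ∀ {j k} → j ≤ k → AtLeastComps P A k → AtLeastComps P A j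
  atLeastComps-mono j≤k (f , Pf , apart) =
    (λ i → f (inject≤ i j≤k)) , (λ _ → Pf _) ,
    (λ i j i≢j → apart _ _ (λ e → i≢j (inject≤-injective j≤k j≤k i j e)))

  atLeastComps⇒≤ : ∀ {k} → AtLeastComps P A k → k ≤ n
  atLeastComps⇒≤ (f , _ , apart) = injective⇒≤ f-injective
    where
    f-injective : ∀ {i j} → f i ≡ f j → i ≡ j
    f-injective {i} {j} fi≡fj with i ≟ j
    ... | yes i≡j = i≡j
    ... | no i≢j = ⊥-elim (apart i j i≢j (subst (Star A (f i)) fi≡fj ε))

  -- Counting components is not constructive, but the bound k ≤ n makes
  -- "no number of components" refutable.
  ¬¬numComps : ¬ ¬ ∃ (NumComps P A)
  ¬¬numComps noCount = search (suc n) 0 ((λ ()) , (λ ()) , (λ ())) (≤-reflexive refl)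
    where
    search : ∀ m k → AtLeastComps P A k → suc n ≤ k + m → ⊥
    search zero    k atK bound =
      <-irrefl refl (≤-trans (subst (suc n ≤_) (+-identityʳ k) bound) (atLeastComps⇒≤ atK))
    search (suc m) k atK bound =
      noCount (k , atK , λ atK+1 → search m (suc k) atK+1 (subst (suc n ≤_) (+-suc k m) bound))

  numComps-≥ : ∀ {c m} → NumComps P A c → AtLeastComps P A m → m ≤ c
  numComps-≥ {c} {m} (_ , notMore) atM with m ≤? c
  ... | yes m≤c = m≤c
  ... | no m≰c = ⊥-elim (notMore (atLeastComps-mono (≰⇒> m≰c) atM))

  atLeastComps-1 : ∀ {v} → P v → AtLeastComps P A 1
  atLeastComps-1 {v} Pv = (λ _ → v) , (λ _ → Pv) , λ { fzero fzero 0≢0 → ⊥-elim (0≢0 refl) }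

  ¬atLeastComps-2 : (∀ u v → Star A u v) → ¬ AtLeastComps P A 2
  ¬atLeastComps-2 conn (f , _ , apart) = apart fzero (fsuc fzero) (λ ()) (conn _ _)

  atLeastComps-3 : (∀ {u v} → A u v → A v u) → ∀ {x y z} → P x → P y → P z →
    ¬ Star A x y → ¬ Star A x z → ¬ Star A y z → AtLeastComps P A 3
  atLeastComps-3 A-sym {x} {y} {z} Px Py Pz x↛y x↛z y↛z = f , Pf , apart
    where
    f : Fin 3 → Fin n
    f fzero = x
    f (fsuc fzero) = y
    f (fsuc (fsuc fzero)) = z
    Pf : ∀ i → P (f i)
    Pf fzero = Px
    Pf (fsuc fzero) = Py
    Pf (fsuc (fsuc fzero)) = Pz
    apart : ∀ i j → i ≢ j → ¬ Star A (f i) (f j)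
    apart fzero               fzero               i≢i = ⊥-elim (i≢i refl)
    apart (fsuc fzero)        (fsuc fzero)        i≢i = ⊥-elim (i≢i refl)
    apart (fsuc (fsuc fzero)) (fsuc (fsuc fzero)) i≢i = ⊥-elim (i≢i refl)
    apart fzero               (fsuc fzero)        _ = x↛y
    apart fzero               (fsuc (fsuc fzero)) _ = x↛z
    apart (fsuc fzero)        (fsuc (fsuc fzero)) _ = y↛z
    apart (fsuc fzero)        fzero               _ = x↛y ∘ reverse A-sym
    apart (fsuc (fsuc fzero)) fzero               _ = x↛z ∘ reverse A-sym
    apart (fsuc (fsuc fzero)) (fsuc fzero)        _ = y↛z ∘ reverse A-sym

sum-map-∈ : ∀ {X : Set} (g : X → ℕ) {v} {l : List X} → v ∈ l → g v ≤ sum (map g l)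
sum-map-∈ g (here refl) = m≤m+n _ _
sum-map-∈ g {l = x ∷ _} (there v∈l) = ≤-trans (sum-map-∈ g v∈l) (m≤n+m _ (g x))

sum-map-pair : ∀ {X : Set} (g : X → ℕ) {v w} {l : List X} → v ∈ l → w ∈ l → v ≢ w →
  g v + g w ≤ sum (map g l)
sum-map-pair g (here refl) (here refl) v≢v = ⊥-elim (v≢v refl)
sum-map-pair g {v} (here refl) (there w∈l) _ = +-monoʳ-≤ (g v) (sum-map-∈ g w∈l)
sum-map-pair g {v} {w} (there v∈l) (here refl) _ =
  ≤-trans (≤-reflexive (+-comm (g v) (g w))) (+-monoʳ-≤ (g w) (sum-map-∈ g v∈l))
sum-map-pair g {l = x ∷ _} (there v∈l) (there w∈l) v≢w =
  ≤-trans (sum-map-pair g v∈l w∈l v≢w) (m≤n+m _ (g x))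

¬three-distinct-in-pair : ∀ {X : Set} {b c x y z : X} →
  x ≡ b ⊎ x ≡ c → y ≡ b ⊎ y ≡ c → z ≡ b ⊎ z ≡ c → x ≢ y → x ≢ z → y ≢ z → ⊥
¬three-distinct-in-pair (inj₁ refl) (inj₁ refl) _ x≢y _ _ = x≢y refl
¬three-distinct-in-pair (inj₂ refl) (inj₂ refl) _ x≢y _ _ = x≢y refl
¬three-distinct-in-pair (inj₁ refl) _ (inj₁ refl) _ x≢z _ = x≢z refl
¬three-distinct-in-pair (inj₂ refl) _ (inj₂ refl) _ x≢z _ = x≢z refl
¬three-distinct-in-pair _ (inj₁ refl) (inj₁ refl) _ _ y≢z = y≢z refl
¬three-distinct-in-pair _ (inj₂ refl) (inj₂ refl) _ _ y≢z = y≢z refl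

module _ {n : ℕ} (G : Graph n) where

  Adj-sym : ∀ {u v} → Adj G u v → Adj G v u
  Adj-sym {u} {v} uv = trans (Graph.sym G v u) uv

  Adj⇒≢ : ∀ {u v} → Adj G u v → u ≢ v
  Adj⇒≢ {u} uv refl with trans (≡-sym uv) (irrefl G u)
  ... | ()

  leaf-neighbour-unique : ∀ {u v w} → Leaf G u → Adj G u v → Adj G u w → v ≡ w
  leaf-neighbour-unique {u} {v} {w} leaf uv uw with v ≟ w
  ... | yes v≡w = v≡w
  ... | no v≢w =
    ⊥-elim (2≰1 (subst (_≤ 1) two-neighbours (subst (indicator v + indicator w ≤_) leaf counted)))
    where
    indicator : Fin n → ℕ
    indicator x = if adj G u x then 1 else 0
    counted : indicator v + indicator w ≤ deg (adj G) u
    counted = sum-map-pair indicator (∈-allFin v) (∈-allFin w) v≢w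
    two-neighbours : indicator v + indicator w ≡ 2
    two-neighbours rewrite uv | uw = refl
    2≰1 : ¬ 2 ≤ 1
    2≰1 (s≤s ())

  DelVAdj-sym : ∀ {x u v} → DelVAdj G x u v → DelVAdj G x v u
  DelVAdj-sym (uv , u≢x , v≢x) = Adj-sym uv , v≢x , u≢x

  DelEAdj-sym : ∀ {a b u v} → DelEAdj G a b u v → DelEAdj G a b v u
  DelEAdj-sym (uv , notAB) = Adj-sym uv , λ
    { (inj₁ (v≡a , u≡b)) → notAB (inj₂ (u≡b , v≡a))
    ; (inj₂ (v≡b , u≡a)) → notAB (inj₁ (u≡a , v≡b)) }

  DelVAdj⇒DelEAdj : ∀ {a b u v} → DelVAdj G b u v → DelEAdj G a b u v
  DelVAdj⇒DelEAdj (uv , u≢b , v≢b) = uv , λ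
    { (inj₁ (_ , v≡b)) → v≢b v≡b
    ; (inj₂ (u≡b , _)) → u≢b u≡b }

  -- A walk to b either passes through b or c or avoids the edge bc, so once
  -- b and c are joined in G − bc, everything reaching b in G does so in G − bc.
  walk-to-avoiding-edge : ∀ {b c} → Star (DelEAdj G b c) b c →
    ∀ {w} → Star (Adj G) w b → Star (DelEAdj G b c) w b
  walk-to-avoiding-edge b↝c ε = ε
  walk-to-avoiding-edge {b} {c} b↝c {w} (wx ◅ x↝b) with w ≟ b | w ≟ c
  ... | yes refl | _ = ε
  ... | no _ | yes refl = reverse DelEAdj-sym b↝c
  ... | no w≢b | no w≢c =
    (wx , λ { (inj₁ (w≡b , _)) → w≢b w≡b ; (inj₂ (w≡c , _)) → w≢c w≡c })
    ◅ walk-to-avoiding-edge b↝c x↝b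

  cutEdge-separates : Connected G → ∀ {b c} → CutEdge G b c → ¬ Star (DelEAdj G b c) b c
  cutEdge-separates conn {b} (_ , c₀ , c₁ , countG , countGbc , c₀<c₁) b↝c =
    ¬atLeastComps-2 AllV (DelEAdj G b _) connected-without-bc
      (atLeastComps-mono AllV (DelEAdj G b _) (≤-trans (s≤s 1≤c₀) c₀<c₁) (proj₁ countGbc))
    where
    1≤c₀ : 1 ≤ c₀
    1≤c₀ = numComps-≥ AllV (Adj G) countG (atLeastComps-1 AllV (Adj G) {b} tt)
    connected-without-bc : ∀ u v → Star (DelEAdj G b _) u v
    connected-without-bc u v =
      walk-to-avoiding-edge b↝c (conn u b)
      ◅◅ reverse DelEAdj-sym (walk-to-avoiding-edge b↝c (conn v b))

  connected⇒numComps-1 : Connected G → Fin n → NumComps AllV (Adj G) 1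
  connected⇒numComps-1 conn v =
    atLeastComps-1 AllV (Adj G) {v} tt , ¬atLeastComps-2 AllV (Adj G) conn

  ¬¬superCutVertex : Connected G → ∀ {x} →
    AtLeastComps (λ w → w ≢ x) (DelVAdj G x) 3 → ¬ ¬ SuperCutVertex G x
  ¬¬superCutVertex conn {x} at3 notSuper =
    ¬¬numComps (λ w → w ≢ x) (DelVAdj G x) λ (k , countGx) →
      let 3≤k = numComps-≥ (λ w → w ≢ x) (DelVAdj G x) countGx at3
          countG = connected⇒numComps-1 conn x
      in notSuper ((1 , k , countG , countGx , ≤-trans (s≤s (s≤s z≤n)) 3≤k) ,
                   (1 , k , countG , countGx , 3≤k))

  leaf-isolated : ∀ {d c w} → Leaf G d → Adj G c d → Star (DelVAdj G c) d w → w ≡ d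
  leaf-isolated leaf cd ε = refl
  leaf-isolated leaf cd ((dx , _ , x≢c) ◅ _) =
    ⊥-elim (x≢c (leaf-neighbour-unique leaf dx (Adj-sym cd)))

  reduced-inner-neighbour : Connected G → Reduced G → ∀ {a b c d y} →
    Adj G a b → Adj G b c → Adj G c d → Leaf G a → Leaf G d →
    b ≢ c → b ≢ d → c ≢ d → Adj G c y → y ≡ b ⊎ y ≡ d
  reduced-inner-neighbour conn (r1 , r2) {a} {b} {c} {d} {y} ab bc cd la ld b≢c b≢d c≢d cy
    with y ≟ b | y ≟ d
  ... | yes y≡b | _ = inj₁ y≡b
  ... | no _ | yes y≡d = inj₂ y≡d
  ... | no y≢b | no y≢d =
    ⊥-elim (¬¬superCutVertex conn three-components (r2 c (d , cd , ld)))
    where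
    bc-cut : CutEdge G b c
    bc-cut = r1 b c bc (a , Adj-sym ab , la) (d , cd , ld)
    y≢c : y ≢ c
    y≢c = ≢-sym (Adj⇒≢ cy)
    yc : DelEAdj G b c y c
    yc = Adj-sym cy , λ { (inj₁ (y≡b , _)) → y≢b y≡b ; (inj₂ (y≡c , _)) → y≢c y≡c }
    b↛y : ¬ Star (DelVAdj G c) b y
    b↛y b↝y = cutEdge-separates conn bc-cut (Star-map DelVAdj⇒DelEAdj b↝y ◅◅ (yc ◅ ε))
    three-components : AtLeastComps (λ w → w ≢ c) (DelVAdj G c) 3
    three-components = atLeastComps-3 _ _ DelVAdj-sym
      (≢-sym c≢d) b≢c y≢c
      (λ d↝b → b≢d (leaf-isolated ld cd d↝b))
      (λ d↝y → y≢d (leaf-isolated ld cd d↝y))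
      b↛y

  Branching : Fin n → Set
  Branching w = ∃₂ λ p q → Adj G w p × Adj G w q × p ≢ q

  cycle⇒three-branching : HasCycle G →
    ∃₂ λ x y → ∃ λ z → Branching x × Branching y × Branching z × x ≢ y × x ≢ z × y ≢ z
  cycle⇒three-branching (k , f , f-inj , step , close) =
    f v₀ , f v₁ , f v₂ ,
    (_ , _ , step fzero , Adj-sym close , λ e → v₁≢vₗ (f-inj e)) ,
    (_ , _ , Adj-sym (step fzero) , step (fsuc fzero) , λ e → v₀≢v₂ (f-inj e)) ,
    third k f f-inj step close ,
    (λ e → v₀≢v₁ (f-inj e)) , (λ e → v₀≢v₂ (f-inj e)) , (λ e → v₁≢v₂ (f-inj e))
    where
    v₀ v₁ v₂ : Fin (suc (suc (suc k)))
    v₀ = fzero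
    v₁ = fsuc fzero
    v₂ = fsuc (fsuc fzero)
    v₀≢v₁ : v₀ ≢ v₁
    v₀≢v₁ ()
    v₀≢v₂ : v₀ ≢ v₂
    v₀≢v₂ ()
    v₁≢v₂ : v₁ ≢ v₂
    v₁≢v₂ ()
    v₁≢vₗ : v₁ ≢ fromℕ (suc (suc k))
    v₁≢vₗ ()
    -- The successor of the third vertex on the cycle is the first one exactly for triangles.
    third : ∀ k (f : Fin (suc (suc (suc k))) → Fin n) → Injective _≡_ _≡_ f →
      (∀ i → Adj G (f (inject₁ i)) (f (fsuc i))) → Adj G (f (fromℕ (suc (suc k)))) (f fzero) →
      Branching (f (fsuc (fsuc fzero)))
    third zero f f-inj step close =
      _ , _ , Adj-sym (step (fsuc fzero)) , close , λ e → v₁≢v₀ (f-inj e)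
      where
      v₁≢v₀ : fsuc {2} fzero ≢ fzero
      v₁≢v₀ ()
    third (suc k) f f-inj step close =
      _ , _ , Adj-sym (step (fsuc fzero)) , step (fsuc (fsuc fzero)) , λ e → v₁≢v₃ (f-inj e)
      where
      v₁≢v₃ : fsuc {suc (suc (suc k))} fzero ≢ fsuc (fsuc (fsuc fzero))
      v₁≢v₃ ()

  two-branching⇒acyclic : ∀ {b c} → (∀ w → Branching w → w ≡ b ⊎ w ≡ c) → ¬ HasCycle G
  two-branching⇒acyclic branching⊆bc cycle
    with cycle⇒three-branching cycle
  ... | x , y , z , bx , by , bz , x≢y , x≢z , y≢z =
    ¬three-distinct-in-pair (branching⊆bc x bx) (branching⊆bc y by) (branching⊆bc z bz) x≢y x≢z y≢z

  module _ (conn : Connected G) {a b c d : Fin n}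
    (ab : Adj G a b) (cd : Adj G c d) (la : Leaf G a) (ld : Leaf G d)
    (N[b] : ∀ y → Adj G b y → y ≡ a ⊎ y ≡ c) (N[c] : ∀ y → Adj G c y → y ≡ b ⊎ y ≡ d) where

    OnPath : Fin n → Set
    OnPath w = w ≡ a ⊎ w ≡ b ⊎ w ≡ c ⊎ w ≡ d

    onPath-step : ∀ {u w} → OnPath u → Adj G u w → OnPath w
    onPath-step (inj₁ refl) uw = inj₂ (inj₁ (leaf-neighbour-unique la uw ab))
    onPath-step (inj₂ (inj₁ refl)) uw with N[b] _ uw
    ... | inj₁ w≡a = inj₁ w≡a
    ... | inj₂ w≡c = inj₂ (inj₂ (inj₁ w≡c))
    onPath-step (inj₂ (inj₂ (inj₁ refl))) uw with N[c] _ uw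
    ... | inj₁ w≡b = inj₂ (inj₁ w≡b)
    ... | inj₂ w≡d = inj₂ (inj₂ (inj₂ w≡d))
    onPath-step (inj₂ (inj₂ (inj₂ refl))) uw =
      inj₂ (inj₂ (inj₁ (leaf-neighbour-unique ld uw (Adj-sym cd))))

    onPath-reach : ∀ {u w} → OnPath u → Star (Adj G) u w → OnPath w
    onPath-reach onU ε = onU
    onPath-reach onU (ux ◅ x↝w) = onPath-reach (onPath-step onU ux) x↝w

    path-branching : ∀ w → Branching w → w ≡ b ⊎ w ≡ c
    path-branching w (p , q , wp , wq , p≢q) with onPath-reach (inj₁ refl) (conn a w)
    ... | inj₁ refl = ⊥-elim (p≢q (leaf-neighbour-unique la wp wq))
    ... | inj₂ (inj₁ w≡b) = inj₁ w≡b
    ... | inj₂ (inj₂ (inj₁ w≡c)) = inj₂ w≡c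
    ... | inj₂ (inj₂ (inj₂ refl)) = ⊥-elim (p≢q (leaf-neighbour-unique ld wp wq))

lemma7 : ∀ {n : ℕ} (G : Graph n) →
    Connected G → ¬ IsTree G → Reduced G →
    (∀ H → IsMaxPCC G H → ¬ SingleComponent H) →
    ∀ (H : Fin n → Fin n → Bool) → IsMaxPCC G H →
    ∀ (a b c d : Fin n) → PathComp3 H a b c d →
    ¬ (Leaf G a × Leaf G d)
lemma7 G conn notTree reduced _ _ (pcc , _) a b c d
  ((a≢b , a≢c , _ , b≢c , b≢d , c≢d) , (hab , hbc , hcd) , _) (la , ld) =
  notTree (conn , two-branching⇒acyclic G (path-branching G conn ab cd la ld N[b] N[c]))
  where
  ab = IsPCC.sub pcc a b hab
  bc = IsPCC.sub pcc b c hbc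
  cd = IsPCC.sub pcc c d hcd
  N[c] : ∀ y → Adj G c y → y ≡ b ⊎ y ≡ d
  N[c] _ = reduced-inner-neighbour G conn reduced ab bc cd la ld b≢c b≢d c≢d
  N[b] : ∀ y → Adj G b y → y ≡ a ⊎ y ≡ c
  N[b] _ by with reduced-inner-neighbour G conn reduced
                   (Adj-sym G cd) (Adj-sym G bc) (Adj-sym G ab) ld la
                   (≢-sym b≢c) (≢-sym a≢c) (≢-sym a≢b) by
  ... | inj₁ y≡c = inj₂ y≡c
  ... | inj₂ y≡a = inj₁ y≡a
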